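{- If $G$ is a bipartite graph, then $\gamma_t(G \,\square\, K_2) = \gamma_{\rm pr}(G \,\square\, K_2) = \gamma_{\rm tr}(G \,\square\, K_2)$.
   Context: Graphs are finite and simple. $G\,\square\,K_2$ is the Cartesian product of $G$ with $K_2$ (the prism of $G$): vertex set $V(G)\times V(K_2)$, with $(u_1,v_1)\sim(u_2,v_2)$ iff either $u_1=u_2$ and $v_1v_2\in E(K_2)$, or $v_1=v_2$ and $u_1u_2\in E(G)$. A total dominating set of a graph $F$ is a set $S\subseteq V(F)$ such that every vertex of $F$ has a neighbor in $S$; $\gamma_t(F)$ is its minimum size. A paired-dominating set is a set $S$ such that every vertex of $F$ is adjacent to a vertex of $S$ and the subgraph induced by $S$ contains a perfect matching; $\gamma_{\rm pr}(F)$ is its minimum size. A total restrained dominating set is a total dominating set $S$ such that every vertex outside $S$ has a neighbor outside $S$; $\gamma_{\rm tr}(F)$ is its minimum size. -}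

module Defs where

open import Data.Nat using (ℕ; _+_; _≤_)
open import Data.Bool using (Bool; true; false; _≟_)
open import Data.Fin using (Fin; splitAt)
open import Data.Fin.Subset using (Subset; _∈_; _∉_; ∣_∣)
open import Data.Sum using (inj₁; inj₂)
open import Data.Product using (Σ; ∃; _×_)
open import Relation.Binary.PropositionalEquality using (_≡_; _≢_)
open import Relation.Nullary using (does)
import Data.Fin as F

record Graph : Set where
  field
    n      : ℕ
    adj    : Fin n → Fin n → Bool
    sym    : ∀ u v → adj u v ≡ adj v u
    irrefl : ∀ u → adj u u ≡ false

open Graph public

Adj : (G : Graph) → Fin (n G) → Fin (n G) → Set
Adj G u v = adj G u v ≡ true

Bipartite : Graph → Set
Bipartite G = Σ (Fin (n G) → Bool) λ c → ∀ u v → Adj G u v → c u ≢ c v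

-- The prism G □ K₂ on vertex set Fin (n + n): vertex (u, 0) is inject u,
-- vertex (u, 1) is raise u  (via splitAt).
prismAdj : (m : ℕ) → (Fin m → Fin m → Bool) → Fin (m + m) → Fin (m + m) → Bool
prismAdj m a i j with splitAt m i | splitAt m j
... | inj₁ u | inj₁ v = a u v
... | inj₂ u | inj₂ v = a u v
... | inj₁ u | inj₂ v = does (u F.≟ v)
... | inj₂ u | inj₁ v = does (u F.≟ v)

module _ {m : ℕ} (a : Fin m → Fin m → Bool) where

  private
    A : Fin m → Fin m → Set
    A u v = a u v ≡ true

  IsTotalDominating : Subset m → Set
  IsTotalDominating S = ∀ v → ∃ λ u → u ∈ S × A v u

  HasPerfectMatching : Subset m → Set
  HasPerfectMatching S = Σ (Fin m → Fin m) λ μ →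
    ∀ u → u ∈ S → (μ u ∈ S) × A u (μ u) × (μ (μ u) ≡ u)

  IsPairedDominating : Subset m → Set
  IsPairedDominating S = IsTotalDominating S × HasPerfectMatching S

  IsTotalRestrainedDominating : Subset m → Set
  IsTotalRestrainedDominating S =
    IsTotalDominating S × (∀ v → v ∉ S → ∃ λ u → u ∉ S × A v u)

IsMinSize : {m : ℕ} → (Subset m → Set) → ℕ → Set
IsMinSize {m} P k = (∃ λ S → P S × ∣ S ∣ ≡ k) × (∀ S → P S → k ≤ ∣ S ∣)

γt≡ γpr≡ γtr≡ : {m : ℕ} → (Fin m → Fin m → Bool) → ℕ → Set
γt≡ a = IsMinSize (IsTotalDominating a)
γpr≡ a = IsMinSize (IsPairedDominating a)
γtr≡ a = IsMinSize (IsTotalRestrainedDominating a)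

-- For any set D of vertices of G, the set D × K₂ of the prism is paired dominating
-- (match each vertex with its twin across the rung) and total restrained dominating
-- (the twin of a vertex outside D × K₂ is outside too) as soon as D dominates G;
-- so all three parameters are at most 2γ(G). Conversely, given a proper 2-colouring c
-- and a total dominating set S of the prism, reading S on layer c(u) at each vertex u
-- gives a dominating set of G, and so does reading it on layer ¬c(u); the two
-- together have |S| vertices, so 2γ(G) ≤ γ_t(G □ K₂) ≤ γ_pr, γ_tr.
module Submission where

open import Defs hiding (sym)
open import Data.Bool using (Bool; true; false; not)
import Data.Bool as Bool
open import Data.Bool.Properties using (not-involutive; not-injective; ¬-not)
open import Data.Fin using (Fin; zero; suc; _↑ˡ_; _↑ʳ_; join; splitAt)
import Data.Fin as Fin
open import Data.Fin.Properties
  using (any?; all?; splitAt-↑ˡ; splitAt-↑ʳ; splitAt⁻¹-↑ˡ; splitAt⁻¹-↑ʳ; splitAt-join; join-splitAt)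
open import Data.Fin.Subset using (Subset; _∈_; _∉_; ∣_∣; ⊤; inside; outside)
open import Data.Fin.Subset.Properties using (_∈?_; anySubset?; ∈⊤)
open import Data.Nat using (ℕ; suc; _+_; _≤_; _<_; _<?_)
open import Data.Nat.Induction using (<-rec)
open import Data.Nat.Properties
  using (+-comm; ≤-trans; ≤-reflexive; ≤-total; +-monoʳ-≤; ≮⇒≥; +-commutativeSemigroup)
open import Algebra.Properties.CommutativeSemigroup +-commutativeSemigroup using (interchange)
open import Data.Product using (Σ; ∃; ∃₂; _×_; _,_; proj₁)
open import Data.Sum using (_⊎_; inj₁; inj₂; swap)
open import Data.Sum.Properties using (swap-involutive)
open import Data.Vec using ([]; _∷_; _++_; lookup; tabulate)
open import Data.Vec.Properties
  using (lookup-++ˡ; lookup-++ʳ; lookup∘tabulate; tabulate∘lookup; []=⇒lookup; lookup⇒[]=)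
open import Function using (_∘_; id)
open import Relation.Binary.PropositionalEquality
open import Relation.Nullary using (yes; no; does)
open import Relation.Nullary.Decidable using (_×-dec_; dec-true)
open import Relation.Unary using (Decidable; _⊆_)

private
  variable
    m k : ℕ

∣p++q∣≡∣p∣+∣q∣ : (p : Subset m) (q : Subset k) → ∣ p ++ q ∣ ≡ ∣ p ∣ + ∣ q ∣
∣p++q∣≡∣p∣+∣q∣ []            q = refl
∣p++q∣≡∣p∣+∣q∣ (outside ∷ p) q = ∣p++q∣≡∣p∣+∣q∣ p q
∣p++q∣≡∣p∣+∣q∣ (inside ∷ p)  q = cong suc (∣p++q∣≡∣p∣+∣q∣ p q)

∣x∷p∣≡∣x∷[]∣+∣p∣ : (x : Bool) (p : Subset k) → ∣ x ∷ p ∣ ≡ ∣ x ∷ [] ∣ + ∣ p ∣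
∣x∷p∣≡∣x∷[]∣+∣p∣ outside p = refl
∣x∷p∣≡∣x∷[]∣+∣p∣ inside  p = refl

∣p++p∣≤∣p∣+∣q∣ : (p q : Subset m) → ∣ p ∣ ≤ ∣ q ∣ → ∣ p ++ p ∣ ≤ ∣ p ∣ + ∣ q ∣
∣p++p∣≤∣p∣+∣q∣ p q ∣p∣≤∣q∣ = ≤-trans (≤-reflexive (∣p++q∣≡∣p∣+∣q∣ p p)) (+-monoʳ-≤ ∣ p ∣ ∣p∣≤∣q∣)

smaller-doubled : {P : Subset m → Set} (p q : Subset m) → P p → P q →
  ∃ λ r → P r × ∣ r ++ r ∣ ≤ ∣ p ∣ + ∣ q ∣
smaller-doubled p q Pp Pq with ≤-total ∣ p ∣ ∣ q ∣
... | inj₁ ∣p∣≤∣q∣ = p , Pp , ∣p++p∣≤∣p∣+∣q∣ p q ∣p∣≤∣q∣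
... | inj₂ ∣q∣≤∣p∣ = q , Pq , ≤-trans (∣p++p∣≤∣p∣+∣q∣ q p ∣q∣≤∣p∣) (≤-reflexive (+-comm ∣ q ∣ ∣ p ∣))

tabulate-++ : ∀ {A : Set} m (g : Fin (m + k) → A) →
              tabulate g ≡ tabulate (g ∘ (_↑ˡ k)) ++ tabulate (g ∘ (m ↑ʳ_))
tabulate-++ ℕ.zero  g = refl
tabulate-++ (suc m) g = cong (g zero ∷_) (tabulate-++ m (g ∘ suc))

-- At each u the pair (f (c u) u , f (not (c u)) u) is (f true u , f false u) up to order.
∣tabulate∣-swap : (c : Fin k → Bool) (f : Bool → Fin k → Bool) →
  ∣ tabulate (λ u → f (c u) u) ∣ + ∣ tabulate (λ u → f (not (c u)) u) ∣
    ≡ ∣ tabulate (f true) ∣ + ∣ tabulate (f false) ∣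
∣tabulate∣-swap {ℕ.zero} c f = refl
∣tabulate∣-swap {suc k}  c f = begin
  ∣ x ∷ A ∣ + ∣ y ∷ B ∣
    ≡⟨ cong₂ _+_ (∣x∷p∣≡∣x∷[]∣+∣p∣ x A) (∣x∷p∣≡∣x∷[]∣+∣p∣ y B) ⟩
  (∣ x ∷ [] ∣ + ∣ A ∣) + (∣ y ∷ [] ∣ + ∣ B ∣)
    ≡⟨ interchange (∣ x ∷ [] ∣) (∣ A ∣) (∣ y ∷ [] ∣) (∣ B ∣) ⟩
  (∣ x ∷ [] ∣ + ∣ y ∷ [] ∣) + (∣ A ∣ + ∣ B ∣)
    ≡⟨ cong₂ _+_ (heads (c zero)) (∣tabulate∣-swap (c ∘ suc) (λ b → f b ∘ suc)) ⟩
  (∣ x′ ∷ [] ∣ + ∣ y′ ∷ [] ∣) + (∣ P ∣ + ∣ Q ∣)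
    ≡⟨ interchange (∣ x′ ∷ [] ∣) (∣ y′ ∷ [] ∣) (∣ P ∣) (∣ Q ∣) ⟩
  (∣ x′ ∷ [] ∣ + ∣ P ∣) + (∣ y′ ∷ [] ∣ + ∣ Q ∣)
    ≡⟨ sym (cong₂ _+_ (∣x∷p∣≡∣x∷[]∣+∣p∣ x′ P) (∣x∷p∣≡∣x∷[]∣+∣p∣ y′ Q)) ⟩
  ∣ x′ ∷ P ∣ + ∣ y′ ∷ Q ∣
    ∎
  where
  open ≡-Reasoning
  x = f (c zero) zero
  y = f (not (c zero)) zero
  x′ = f true zero
  y′ = f false zero
  A = tabulate (λ u → f (c (suc u)) (suc u))
  B = tabulate (λ u → f (not (c (suc u))) (suc u))
  P = tabulate (f true ∘ suc)
  Q = tabulate (f false ∘ suc)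
  heads : ∀ b → ∣ f b zero ∷ [] ∣ + ∣ f (not b) zero ∷ [] ∣ ≡ ∣ x′ ∷ [] ∣ + ∣ y′ ∷ [] ∣
  heads true  = refl
  heads false = +-comm (∣ y′ ∷ [] ∣) (∣ x′ ∷ [] ∣)

minSize-exists : {P : Subset m → Set} → Decidable P → ∃ P → ∃ (IsMinSize P)
minSize-exists {P = P} P? (S , pS) = <-rec Goal step ∣ S ∣ S pS refl
  where
  Goal : ℕ → Set
  Goal k = ∀ S → P S → ∣ S ∣ ≡ k → ∃ (IsMinSize P)
  step : ∀ k → (∀ {j} → j < k → Goal j) → Goal k
  step k smaller S pS ∣S∣≡k with anySubset? (λ T → P? T ×-dec (∣ T ∣ <? k))
  ... | yes (T , pT , ∣T∣<k) = smaller ∣T∣<k T pT refl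
  ... | no ¬smaller =
    k , (S , pS , ∣S∣≡k) , λ T pT → ≮⇒≥ (λ ∣T∣<k → ¬smaller (T , pT , ∣T∣<k))

IsMinSize-⊆ : {P Q : Subset m → Set} {k : ℕ} {S : Subset m} →
  Q ⊆ P → IsMinSize P k → Q S → ∣ S ∣ ≤ k → IsMinSize Q ∣ S ∣
IsMinSize-⊆ {S = S} Q⊆P (_ , P-min) qS ∣S∣≤k =
  (S , qS , refl) , λ T qT → ≤-trans ∣S∣≤k (P-min T (Q⊆P qT))

module _ (a : Fin m → Fin m → Bool) where

  Dominating : Subset m → Set
  Dominating D = ∀ v → v ∈ D ⊎ ∃ λ u → u ∈ D × a v u ≡ true

  ProperColouring : (Fin m → Bool) → Set
  ProperColouring c = ∀ u v → a u v ≡ true → c u ≢ c v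

  IsTotalDominating? : Decidable (IsTotalDominating a)
  IsTotalDominating? S = all? λ v → any? λ u → (u ∈? S) ×-dec (a v u Bool.≟ true)

ProperColouring-not : {a : Fin m → Fin m → Bool} {c : Fin m → Bool} →
  ProperColouring a c → ProperColouring a (not ∘ c)
ProperColouring-not proper u v auv = proper u v auv ∘ not-injective

module Prism {m : ℕ} (a : Fin m → Fin m → Bool) where

  -- The layer true is the copy V(G) × {0}, reached by _↑ˡ m, as in prismAdj.
  embed : Bool → Fin m → Fin (m + m)
  embed true  u = u ↑ˡ m
  embed false u = m ↑ʳ u

  embed-surjective : ∀ i → ∃₂ λ b u → i ≡ embed b u
  embed-surjective i with splitAt m i in eq
  ... | inj₁ u = true  , u , sym (splitAt⁻¹-↑ˡ eq)
  ... | inj₂ u = false , u , sym (splitAt⁻¹-↑ʳ eq)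

  prismAdj-layer : ∀ b u v → prismAdj m a (embed b u) (embed b v) ≡ a u v
  prismAdj-layer true  u v rewrite splitAt-↑ˡ m u m | splitAt-↑ˡ m v m = refl
  prismAdj-layer false u v rewrite splitAt-↑ʳ m m u | splitAt-↑ʳ m m v = refl

  prismAdj-rung : ∀ b u v → prismAdj m a (embed b u) (embed (not b) v) ≡ does (u Fin.≟ v)
  prismAdj-rung true  u v rewrite splitAt-↑ˡ m u m | splitAt-↑ʳ m m v = refl
  prismAdj-rung false u v rewrite splitAt-↑ʳ m m u | splitAt-↑ˡ m v m = refl

  rung-adjacent : ∀ b u → prismAdj m a (embed b u) (embed (not b) u) ≡ true
  rung-adjacent b u = trans (prismAdj-rung b u u) (dec-true (u Fin.≟ u) refl)

  rung-endpoints : ∀ b u v → prismAdj m a (embed b u) (embed (not b) v) ≡ true → u ≡ v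
  rung-endpoints b u v adj with u Fin.≟ v | prismAdj-rung b u v
  ... | yes u≡v | _   = u≡v
  ... | no _    | rung with () ← trans (sym rung) adj

  twin : Fin (m + m) → Fin (m + m)
  twin = join m m ∘ swap ∘ splitAt m

  twin-embed : ∀ b u → twin (embed b u) ≡ embed (not b) u
  twin-embed true  u rewrite splitAt-↑ˡ m u m = refl
  twin-embed false u rewrite splitAt-↑ʳ m m u = refl

  twin-involutive : ∀ i → twin (twin i) ≡ i
  twin-involutive i = begin
    join m m (swap (splitAt m (join m m (swap (splitAt m i)))))
      ≡⟨ cong (join m m ∘ swap) (splitAt-join m m (swap (splitAt m i))) ⟩
    join m m (swap (swap (splitAt m i)))
      ≡⟨ cong (join m m) (swap-involutive (splitAt m i)) ⟩
    join m m (splitAt m i)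
      ≡⟨ join-splitAt m m i ⟩
    i ∎
    where open ≡-Reasoning

  twin-adjacent : ∀ i → prismAdj m a i (twin i) ≡ true
  twin-adjacent i with embed-surjective i
  ... | b , u , refl rewrite twin-embed b u = rung-adjacent b u

  lookup-double : ∀ (D : Subset m) b u → lookup (D ++ D) (embed b u) ≡ lookup D u
  lookup-double D true  u = lookup-++ˡ D D u
  lookup-double D false u = lookup-++ʳ D D u

  ∈-double⁺ : ∀ {D : Subset m} b {u} → u ∈ D → embed b u ∈ D ++ D
  ∈-double⁺ {D} b {u} u∈D = lookup⇒[]= _ (D ++ D) (trans (lookup-double D b u) ([]=⇒lookup u∈D))

  ∈-double⁻ : ∀ (D : Subset m) b {u} → embed b u ∈ D ++ D → u ∈ D
  ∈-double⁻ D b {u} e∈ = lookup⇒[]= u D (trans (sym (lookup-double D b u)) ([]=⇒lookup e∈))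

  twin-∈-double : ∀ (D : Subset m) {i} → i ∈ D ++ D → twin i ∈ D ++ D
  twin-∈-double D {i} i∈ with embed-surjective i
  ... | b , u , refl rewrite twin-embed b u = ∈-double⁺ (not b) (∈-double⁻ D b i∈)

  twin-∉-double : ∀ (D : Subset m) {i} → i ∉ D ++ D → twin i ∉ D ++ D
  twin-∉-double D {i} i∉ ti∈ = i∉ (subst (_∈ D ++ D) (twin-involutive i) (twin-∈-double D ti∈))

  double-totalDominating : ∀ D → Dominating a D → IsTotalDominating (prismAdj m a) (D ++ D)
  double-totalDominating D dom i with embed-surjective i
  ... | b , v , refl with dom v
  ...   | inj₁ v∈D             = embed (not b) v , ∈-double⁺ (not b) v∈D , rung-adjacent b v
  ...   | inj₂ (u , u∈D , avu) = embed b u , ∈-double⁺ b u∈D , trans (prismAdj-layer b v u) avu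

  double-perfectMatching : ∀ D → HasPerfectMatching (prismAdj m a) (D ++ D)
  double-perfectMatching D = twin , λ i i∈ → twin-∈-double D i∈ , twin-adjacent i , twin-involutive i

  double-pairedDominating : ∀ D → Dominating a D → IsPairedDominating (prismAdj m a) (D ++ D)
  double-pairedDominating D dom = double-totalDominating D dom , double-perfectMatching D

  double-totalRestrainedDominating : ∀ D → Dominating a D →
    IsTotalRestrainedDominating (prismAdj m a) (D ++ D)
  double-totalRestrainedDominating D dom =
    double-totalDominating D dom , λ i i∉ → twin i , twin-∉-double D i∉ , twin-adjacent i

  slice : (Fin m → Bool) → Subset (m + m) → Subset m
  slice c S = tabulate λ u → lookup S (embed (c u) u)

  ∈-slice⁺ : ∀ c S {u} → embed (c u) u ∈ S → u ∈ slice c S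
  ∈-slice⁺ c S {u} e∈ = lookup⇒[]= u (slice c S) (trans (lookup∘tabulate _ u) ([]=⇒lookup e∈))

  ∣slice∣+∣slice-not∣ : ∀ c S → ∣ slice c S ∣ + ∣ slice (not ∘ c) S ∣ ≡ ∣ S ∣
  ∣slice∣+∣slice-not∣ c S = begin
    ∣ slice c S ∣ + ∣ slice (not ∘ c) S ∣
      ≡⟨ ∣tabulate∣-swap c layer ⟩
    ∣ tabulate (layer true) ∣ + ∣ tabulate (layer false) ∣
      ≡⟨ sym (∣p++q∣≡∣p∣+∣q∣ (tabulate (layer true)) (tabulate (layer false))) ⟩
    ∣ tabulate (layer true) ++ tabulate (layer false) ∣
      ≡⟨ cong ∣_∣ (sym (tabulate-++ m (lookup S))) ⟩
    ∣ tabulate (lookup S) ∣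
      ≡⟨ cong ∣_∣ (tabulate∘lookup S) ⟩
    ∣ S ∣ ∎
    where
    open ≡-Reasoning
    layer : Bool → Fin m → Bool
    layer b u = lookup S (embed b u)

  neighbour-in-layer : ∀ {S} → IsTotalDominating (prismAdj m a) S → ∀ b v →
    (∃ λ w → embed b w ∈ S × a v w ≡ true) ⊎ embed (not b) v ∈ S
  neighbour-in-layer td b v with td (embed b v)
  ... | i , i∈S , adj with embed-surjective i
  ...   | b′ , w , refl with b′ Bool.≟ b
  ...     | yes refl = inj₁ (w , i∈S , trans (sym (prismAdj-layer b v w)) adj)
  ...     | no b′≢b with ¬-not b′≢b
  ...       | refl rewrite sym (rung-endpoints b v w adj) = inj₂ i∈S

  -- A neighbour of (v, ¬c v) in S lies either on the rung, i.e. at (v, c v), or at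
  -- some (w, ¬c v) with w ~ v, and then ¬c v = c w.
  slice-dominating : ∀ {c S} → ProperColouring a c →
    IsTotalDominating (prismAdj m a) S → Dominating a (slice c S)
  slice-dominating {c} {S} proper td v with neighbour-in-layer td (not (c v)) v
  ... | inj₂ e∈ rewrite not-involutive (c v) = inj₁ (∈-slice⁺ c S e∈)
  ... | inj₁ (w , e∈ , avw) rewrite sym (¬-not (proper v w avw ∘ sym)) =
    inj₂ (w , ∈-slice⁺ c S e∈ , avw)

  half-dominating : ∀ {c S} → ProperColouring a c → IsTotalDominating (prismAdj m a) S →
    ∃ λ D → Dominating a D × ∣ D ++ D ∣ ≤ ∣ S ∣
  half-dominating {c} {S} proper td =
    let D , domD , ∣D++D∣≤ = smaller-doubled {P = Dominating a} (slice c S) (slice (not ∘ c) S)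
                               (slice-dominating proper td)
                               (slice-dominating (ProperColouring-not proper) td)
    in D , domD , ≤-trans ∣D++D∣≤ (≤-reflexive (∣slice∣+∣slice-not∣ c S))

corollary3 : (G : Graph) → Bipartite G →
    Σ ℕ λ k → γt≡ (prismAdj (n G) (adj G)) k
    × γpr≡ (prismAdj (n G) (adj G)) k
    × γtr≡ (prismAdj (n G) (adj G)) k
corollary3 G (c , proper) =
  let k , γt = minSize-exists (IsTotalDominating? (prismAdj (n G) (adj G)))
                              (⊤ {n G} ++ ⊤ , double-totalDominating ⊤ λ _ → inj₁ ∈⊤)
      (M , tdM , ∣M∣≡k) , _ = γt
      D , domD , ∣D++D∣≤∣M∣ = half-dominating proper tdM
      ∣D++D∣≤k = ≤-trans ∣D++D∣≤∣M∣ (≤-reflexive ∣M∣≡k)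
  in ∣ D ++ D ∣ ,
     IsMinSize-⊆ id γt (double-totalDominating D domD) ∣D++D∣≤k ,
     IsMinSize-⊆ proj₁ γt (double-pairedDominating D domD) ∣D++D∣≤k ,
     IsMinSize-⊆ proj₁ γt (double-totalRestrainedDominating D domD) ∣D++D∣≤k
  where open Prism (adj G)
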